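{- For every positive integer $n$, $\max\{d_W(\sigma,\rho):\sigma,\rho\in P^B(\emptyset;n)\}=n^2$.
   Context: $S^B_n$ is the group (under composition) of all bijections $\sigma$ of $\{ -n,\dots,-1,1,\dots,n\}$ with $\sigma(-i)=-\sigma(i)$, written in one-line notation $\sigma(1)\cdots\sigma(n)$. $\sigma$ has a peak at $i\in\{2,\dots,n-1\}$ if $\sigma(i-1)<\sigma(i)>\sigma(i+1)$; $Peak(\sigma)$ is the set of such $i$, and $P^B(S;n)=\{\sigma\in S^B_n : Peak(\sigma)=S\}$. The word metric is $d_W(\sigma,\pi)=\ell_B(\pi^{ -1}\sigma)$, where $\ell_B(\gamma)$ is the minimum number of factors needed to write $\gamma$ as a product of the Coxeter generators $s_0^B,\dots,s_{n-1}^B$: $s_0^B$ swaps $1$ and $-1$, and for $1\le i<n$, $s_i^B$ swaps $i$ with $i+1$ and $-i$ with $-(i+1)$. -}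

module Defs where

open import Data.Bool using (Bool; true; false; not)
open import Data.Nat using (ℕ; zero; suc; _+_; _≤_; _^_)
open import Data.Integer using (ℤ; +_; -[1+_]) renaming (_<_ to _<ℤ_)
open import Data.Fin using (Fin; zero; suc; toℕ; inject₁)
open import Data.Fin.Permutation.Components using (transpose)
open import Data.List using (List; []; _∷_; length)
open import Data.Product using (Σ; Σ-syntax; _×_; _,_; ∃-syntax)
open import Relation.Binary.PropositionalEquality using (_≡_; refl; cong; trans; sym)
open import Relation.Nullary using (¬_)
open import Function using (_∘_; id)

-- The signed set {-n,…,-1,1,…,n}: (s , j) stands for ±(toℕ j + 1),
-- with sign s = true meaning negative.
S : ℕ → Set
S n = Bool × Fin n

neg : ∀ {n} → S n → S n
neg (s , j) = (not s , j)

toℤ : ∀ {n} → S n → ℤ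
toℤ (false , j) = + suc (toℕ j)
toℤ (true  , j) = -[1+ toℕ j ]

record SignedPerm (n : ℕ) : Set where
  field
    fun    : S n → S n
    inv    : S n → S n
    inv∘fun : ∀ x → inv (fun x) ≡ x
    fun∘inv : ∀ x → fun (inv x) ≡ x
    odd    : ∀ x → fun (neg x) ≡ neg (fun x)
open SignedPerm public

_·_ : ∀ {n} → SignedPerm n → SignedPerm n → SignedPerm n
σ · π = record
  { fun = fun σ ∘ fun π
  ; inv = inv π ∘ inv σ
  ; inv∘fun = λ x → trans (cong (inv π) (inv∘fun σ (fun π x))) (inv∘fun π x)
  ; fun∘inv = λ x → trans (cong (fun σ) (fun∘inv π (inv σ x))) (fun∘inv σ x)
  ; odd = λ x → trans (cong (fun σ) (odd π x)) (odd σ (fun π x))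
  }

_⁻¹ : ∀ {n} → SignedPerm n → SignedPerm n
σ ⁻¹ = record
  { fun = inv σ
  ; inv = fun σ
  ; inv∘fun = fun∘inv σ
  ; fun∘inv = inv∘fun σ
  ; odd = λ x → trans (cong (λ y → inv σ (neg y)) (sym (fun∘inv σ x)))
                  (trans (cong (inv σ) (sym (odd σ (inv σ x))))
                         (trans (inv∘fun σ (neg (inv σ x))) refl))
  }

-- One-line notation: value σ(i) for positions i = toℕ j + 1.
oneLine : ∀ {n} → SignedPerm n → Fin n → ℤ
oneLine σ j = toℤ (fun σ (false , j))

-- σ has a peak at position i (1-indexed): positions i-1, i, i+1 exist
-- (forcing 2 ≤ i ≤ n-1) and σ(i-1) < σ(i) > σ(i+1).
IsPeak : ∀ {n} → SignedPerm n → ℕ → Set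
IsPeak {n} σ i =
  Σ[ a ∈ Fin n ] Σ[ b ∈ Fin n ] Σ[ c ∈ Fin n ]
    (suc (toℕ b) ≡ i) × (suc (toℕ a) ≡ toℕ b) × (toℕ c ≡ suc (toℕ b)) ×
    (oneLine σ a <ℤ oneLine σ b) × (oneLine σ c <ℤ oneLine σ b)

NoPeaks : ∀ {n} → SignedPerm n → Set
NoPeaks σ = ∀ i → ¬ IsPeak σ i

-- Coxeter generators, indexed by k : Fin n (k = 0 gives s_0^B,
-- k = suc j gives s_{j+1}^B swapping positions j+1 and j+2 and their negatives).
gen : ∀ {n} → Fin n → S n → S n
gen zero    (s , zero)  = (not s , zero)
gen zero    (s , suc j) = (s , suc j)
gen (suc k) (s , x)     = (s , transpose (inject₁ k) (suc k) x)

evalWord : ∀ {n} → List (Fin n) → S n → S n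
evalWord []      = id
evalWord (k ∷ w) = gen k ∘ evalWord w

Expresses : ∀ {n} → List (Fin n) → SignedPerm n → Set
Expresses w γ = ∀ x → evalWord w x ≡ fun γ x

LengthB : ∀ {n} → SignedPerm n → ℕ → Set
LengthB γ m = (Σ[ w ∈ List _ ] (Expresses w γ × length w ≡ m))
            × (∀ w → Expresses w γ → m ≤ length w)

WordDist : ∀ {n} → SignedPerm n → SignedPerm n → ℕ → Set
WordDist σ π m = LengthB ((π ⁻¹) · σ) m

{-# OPTIONS --safe #-}
module Submission where

-- The Coxeter length of a signed permutation is the statistic
--   inv_B σ = #{i : σ(i) < 0} + #{i < j : σ(j) < σ(i)} + #{i < j : σ(i) + σ(j) < 0}
-- of its one-line notation.  Right multiplication by a generator changes inv_B by at
-- most one, and lowers it by exactly one at a descent; since only the identity has no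
-- descents, sorting along descents yields a word of length inv_B σ, and no word is
-- shorter.  Each of the n entries contributes at most 1 and each of the n(n-1)/2
-- pairs at most 2, so inv_B σ ≤ n², with equality for w₀ = -1 -2 ⋯ -n.  Both w₀ and
-- the identity are monotone, hence peak-free, so the diameter n² of the whole group is
-- already realised inside P^B(∅; n).

open import Data.Nat using (ℕ; _≤_; _*_; NonZero)
open import Data.Product using (Σ-syntax; _×_)
open import Defs

open import Data.Bool using (false; true)
open import Data.Bool.Properties using (not-involutive)
open import Data.Fin using (Fin; zero; suc; toℕ; inject₁; fromℕ) renaming (_<_ to _<ᶠ_)
open import Data.Fin.Induction using (<-weakInduction; >-weakInduction)
import Data.Fin.Permutation as Permutation
open import Data.Fin.Permutation.Components using (transpose)
open import Data.Fin.Properties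
  using (_≟_; any?; toℕ-injective; toℕ-inject₁; toℕ-fromℕ; toℕ<n)
open import Data.Integer using (ℤ; +_; -_; 0ℤ; _<?_; +<+; -<+; -<-; +≤+; -≤+)
  renaming (_<_ to _<ℤ_; _≤_ to _≤ℤ_)
import Data.Integer.Properties as ℤ
open import Data.List using (List; []; _∷_; _∷ʳ_; length)
open import Data.List.Properties using (length-++)
open import Data.Nat using (zero; suc; _+_; _<_; z≤n; s≤s)
open import Data.Nat.Properties
  using ( +-0-commutativeMonoid; +-comm; +-assoc; +-identityʳ; +-suc; +-mono-≤
        ; +-monoˡ-≤; +-monoʳ-≤; *-zeroʳ; m≤m+n; ≤-reflexive; ≤-antisym; <-irrefl
        ; n<1+n; suc-injective; 0≢1+n; 1+n≢0; module ≤-Reasoning)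
open import Data.Nat.Tactic.RingSolver using (solve-∀)
open import Data.Product using (_,_; proj₂)
open import Data.Vec.Functional using (head; tail)
import Data.Vec.Functional as Vector
open import Function using (_∘_; id)
open import Relation.Binary.PropositionalEquality
  using (_≡_; _≢_; _≗_; refl; sym; trans; cong; cong₂; subst; module ≡-Reasoning)
open import Relation.Nullary using (Dec; yes; no; ¬_; contradiction)
open import Relation.Nullary.Decidable using (dec-true; dec-false)

open import Algebra.Properties.CommutativeMonoid.Sum +-0-commutativeMonoid
  using (sum; sum-cong-≗; sum-permute)

𝟙 : {P : Set} → Dec P → ℕ
𝟙 (yes _) = 1
𝟙 (no _)  = 0

𝟙-yes : {P : Set} (p? : Dec P) → P → 𝟙 p? ≡ 1
𝟙-yes (yes _) _ = refl
𝟙-yes (no ¬p) p = contradiction p ¬p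

𝟙-no : {P : Set} (p? : Dec P) → ¬ P → 𝟙 p? ≡ 0
𝟙-no (yes p) ¬p = contradiction p ¬p
𝟙-no (no _)  _  = refl

𝟙≤1 : {P : Set} (p? : Dec P) → 𝟙 p? ≤ 1
𝟙≤1 (yes _) = s≤s z≤n
𝟙≤1 (no _)  = z≤n

𝟙-cong : {P Q : Set} (p? : Dec P) (q? : Dec Q) → (P → Q) → (Q → P) → 𝟙 p? ≡ 𝟙 q?
𝟙-cong (yes _) (yes _) _   _   = refl
𝟙-cong (yes p) (no ¬q) p→q _   = contradiction (p→q p) ¬q
𝟙-cong (no ¬p) (yes q) _   q→p = contradiction (q→p q) ¬p
𝟙-cong (no _)  (no _)  _   _   = refl

exchange⇒≤suc : ∀ {P Q : Set} (p? : Dec P) (q? : Dec Q) {x y} →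
  x + 𝟙 p? ≡ y + 𝟙 q? → y ≤ suc x
exchange⇒≤suc p? q? {x} {y} eq = begin
  y          ≤⟨ m≤m+n y (𝟙 q?) ⟩
  y + 𝟙 q?   ≡⟨ eq ⟨
  x + 𝟙 p?   ≤⟨ +-monoʳ-≤ x (𝟙≤1 p?) ⟩
  x + 1      ≡⟨ +-comm x 1 ⟩
  suc x      ∎
  where open ≤-Reasoning

exchange⇒≡suc : ∀ {P Q : Set} (p? : Dec P) (q? : Dec Q) {x y} →
  ¬ P → Q → x + 𝟙 p? ≡ y + 𝟙 q? → x ≡ suc y
exchange⇒≡suc p? q? {x} {y} ¬p q eq = begin
  x          ≡⟨ +-identityʳ x ⟨
  x + 0      ≡⟨ cong (_+_ x) (𝟙-no p? ¬p) ⟨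
  x + 𝟙 p?   ≡⟨ eq ⟩
  y + 𝟙 q?   ≡⟨ cong (_+_ y) (𝟙-yes q? q) ⟩
  y + 1      ≡⟨ +-comm y 1 ⟩
  suc y      ∎
  where open ≡-Reasoning

sum-const : ∀ {n} (f : Fin n → ℕ) {c} → (∀ i → f i ≡ c) → sum f ≡ n * c
sum-const {zero}  f f≡c = refl
sum-const {suc n} f f≡c = cong₂ _+_ (f≡c zero) (sum-const (tail f) (f≡c ∘ suc))

sum-≤-const : ∀ {n} (f : Fin n → ℕ) {c} → (∀ i → f i ≤ c) → sum f ≤ n * c
sum-≤-const {zero}  f f≤c = z≤n
sum-≤-const {suc n} f f≤c = +-mono-≤ (f≤c zero) (sum-≤-const (tail f) (f≤c ∘ suc))

transpose-involutive : ∀ {n} (i j k : Fin n) → transpose i j (transpose i j k) ≡ k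
transpose-involutive i j k with k ≟ i
... | yes refl with j ≟ k
...   | yes refl = refl
...   | no _ rewrite dec-true (j ≟ j) refl = refl
transpose-involutive i j k | no k≢i with k ≟ j
... | yes refl rewrite dec-true (i ≟ i) refl = refl
... | no k≢j rewrite dec-false (k ≟ i) k≢i | dec-false (k ≟ j) k≢j = refl

<-neg-swap : ∀ a b → b <ℤ - a → a <ℤ - b
<-neg-swap a b b<-a = subst (_<ℤ - b) (ℤ.neg-involutive a) (ℤ.neg-mono-< b<-a)

pairInversions : ℤ → ℤ → ℕ
pairInversions a b = 𝟙 (b <? a) + 𝟙 (b <? - a)

pairInversions-neg : ∀ a b → pairInversions (- a) b ≡ pairInversions a b
pairInversions-neg a b rewrite ℤ.neg-involutive a = +-comm (𝟙 (b <? - a)) (𝟙 (b <? a))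

pairInversions≤2 : ∀ a b → pairInversions a b ≤ 2
pairInversions≤2 a b = +-mono-≤ (𝟙≤1 (b <? a)) (𝟙≤1 (b <? - a))

inversionsB : ∀ {n} → (Fin n → ℤ) → ℕ
inversionsB {zero}  g = 0
inversionsB {suc n} g =
  𝟙 (head g <? 0ℤ) + sum (pairInversions (head g) ∘ tail g) + inversionsB (tail g)

inversionsB-cong : ∀ {n} {g h : Fin n → ℤ} → g ≗ h → inversionsB g ≡ inversionsB h
inversionsB-cong {zero}  g≗h = refl
inversionsB-cong {suc n} g≗h = cong₂ _+_
  (cong₂ _+_ (cong (λ a → 𝟙 (a <? 0ℤ)) (g≗h zero))
             (sum-cong-≗ (λ j → cong₂ pairInversions (g≗h zero) (g≗h (suc j)))))
  (inversionsB-cong (g≗h ∘ suc))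

inversionsB-negateHead : ∀ {n} a (t : Fin n → ℤ) →
  inversionsB (a Vector.∷ t) + 𝟙 (- a <? 0ℤ) ≡ inversionsB (- a Vector.∷ t) + 𝟙 (a <? 0ℤ)
inversionsB-negateHead a t
  rewrite sum-cong-≗ (pairInversions-neg a ∘ t) =
    swap-ends (𝟙 (a <? 0ℤ)) (sum (pairInversions a ∘ t)) (inversionsB t) (𝟙 (- a <? 0ℤ))
  where
  swap-ends : ∀ x s i y → x + s + i + y ≡ y + s + i + x
  swap-ends = solve-∀

-- Only the indicator [b < a] of the swapped pair changes: its negative-sum indicator
-- is symmetric, and every other term is merely permuted.
inversionsB-transpose : ∀ {n} (k : Fin n) (g : Fin (suc n) → ℤ) →
  inversionsB g + 𝟙 (g (inject₁ k) <? g (suc k)) ≡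
  inversionsB (g ∘ transpose (inject₁ k) (suc k)) + 𝟙 (g (suc k) <? g (inject₁ k))
inversionsB-transpose {suc n} zero g = trans
  (shuffle na nb x y (𝟙 (b <? - a)) Σa Σb (inversionsB t))
  (cong (λ c → nb + (y + c + Σb) + (na + Σa + inversionsB t) + x)
        (𝟙-cong (b <? - a) (a <? - b) (<-neg-swap a b) (<-neg-swap b a)))
  where
  a b : ℤ
  a = g zero
  b = g (suc zero)
  t : Fin n → ℤ
  t = tail (tail g)
  na nb x y Σa Σb : ℕ
  na = 𝟙 (a <? 0ℤ)
  nb = 𝟙 (b <? 0ℤ)
  x = 𝟙 (b <? a)
  y = 𝟙 (a <? b)
  Σa = sum (pairInversions a ∘ t)
  Σb = sum (pairInversions b ∘ t)
  shuffle : ∀ na nb x y c Σa Σb ι →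
    na + (x + c + Σa) + (nb + Σb + ι) + y ≡ nb + (y + c + Σb) + (na + Σa + ι) + x
  shuffle = solve-∀
inversionsB-transpose {suc n} (suc k) g = begin
  negHead + pairs + rest + x      ≡⟨ +-assoc (negHead + pairs) rest x ⟩
  negHead + pairs + (rest + x)    ≡⟨ cong₂ (λ p r → negHead + p + r) pairs≡pairs′ rest+x≡rest′+y ⟩
  negHead + pairs′ + (rest′ + y)  ≡⟨ +-assoc (negHead + pairs′) rest′ y ⟨
  negHead + pairs′ + rest′ + y    ∎
  where
  open ≡-Reasoning
  τ : Fin (suc n) → Fin (suc n)
  τ = transpose (inject₁ k) (suc k)
  τ′ : Fin (suc (suc n)) → Fin (suc (suc n))
  τ′ = transpose (inject₁ (suc k)) (suc (suc k))
  τ′-suc : ∀ j → τ′ (suc j) ≡ suc (τ j)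
  τ′-suc = Permutation.lift₀-transpose (inject₁ k) (suc k) ∘ suc
  negHead x y pairs pairs′ rest rest′ : ℕ
  negHead = 𝟙 (g zero <? 0ℤ)
  x = 𝟙 (g (inject₁ (suc k)) <? g (suc (suc k)))
  y = 𝟙 (g (suc (suc k)) <? g (inject₁ (suc k)))
  pairs = sum (pairInversions (g zero) ∘ tail g)
  pairs′ = sum (pairInversions (g zero) ∘ tail (g ∘ τ′))
  rest = inversionsB (tail g)
  rest′ = inversionsB (tail (g ∘ τ′))
  pairs≡pairs′ : pairs ≡ pairs′
  pairs≡pairs′ = trans
    (sum-permute (pairInversions (g zero) ∘ tail g) (Permutation.transpose (inject₁ k) (suc k)))
    (sum-cong-≗ (cong (pairInversions (g zero) ∘ g) ∘ sym ∘ τ′-suc))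
  rest+x≡rest′+y : rest + x ≡ rest′ + y
  rest+x≡rest′+y = trans (inversionsB-transpose k (tail g))
                         (cong (_+ y) (inversionsB-cong (cong g ∘ sym ∘ τ′-suc)))

square-suc : ∀ n → 1 + n * 2 + n * n ≡ suc n * suc n
square-suc = solve-∀

inversionsB≤n² : ∀ {n} (g : Fin n → ℤ) → inversionsB g ≤ n * n
inversionsB≤n² {zero}  g = z≤n
inversionsB≤n² {suc n} g = subst (inversionsB g ≤_) (square-suc n)
  (+-mono-≤ (+-mono-≤ (𝟙≤1 (head g <? 0ℤ)) (sum-≤-const _ (pairInversions≤2 (head g) ∘ tail g)))
            (inversionsB≤n² (tail g)))

Increasing Decreasing : ∀ {n} → (Fin n → ℤ) → Set
Increasing g = ∀ {i j} → i <ᶠ j → g i <ℤ g j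
Decreasing g = ∀ {i j} → i <ᶠ j → g j <ℤ g i

inversionsB-increasing-positive : ∀ {n} (g : Fin n → ℤ) →
  (∀ i → 0ℤ <ℤ g i) → Increasing g → inversionsB g ≡ 0
inversionsB-increasing-positive {zero}  g pos inc = refl
inversionsB-increasing-positive {suc n} g pos inc = cong₂ _+_
  (cong₂ _+_ (𝟙-no (head g <? 0ℤ) (ℤ.<-asym (pos zero)))
             (trans (sum-const (pairInversions (head g) ∘ tail g) no-pair) (*-zeroʳ n)))
  (inversionsB-increasing-positive (tail g) (pos ∘ suc) (inc ∘ s≤s))
  where
  -g₀<0 : - head g <ℤ 0ℤ
  -g₀<0 = ℤ.neg-mono-< (pos zero)
  no-pair : ∀ j → pairInversions (head g) (g (suc j)) ≡ 0
  no-pair j = cong₂ _+_ (𝟙-no (g (suc j) <? head g) (ℤ.<-asym (inc (s≤s z≤n))))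
                        (𝟙-no (g (suc j) <? - head g) (ℤ.<-asym (ℤ.<-trans -g₀<0 (pos (suc j)))))

inversionsB-decreasing-negative : ∀ {n} (g : Fin n → ℤ) →
  (∀ i → g i <ℤ 0ℤ) → Decreasing g → inversionsB g ≡ n * n
inversionsB-decreasing-negative {zero}  g neg dec = refl
inversionsB-decreasing-negative {suc n} g neg dec = trans (cong₂ _+_
  (cong₂ _+_ (𝟙-yes (head g <? 0ℤ) (neg zero))
             (sum-const (pairInversions (head g) ∘ tail g) both-pairs))
  (inversionsB-decreasing-negative (tail g) (neg ∘ suc) (dec ∘ s≤s))) (square-suc n)
  where
  0<-g₀ : 0ℤ <ℤ - head g
  0<-g₀ = ℤ.neg-mono-< (neg zero)
  both-pairs : ∀ j → pairInversions (head g) (g (suc j)) ≡ 2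
  both-pairs j = cong₂ _+_ (𝟙-yes (g (suc j) <? head g) (dec (s≤s z≤n)))
                           (𝟙-yes (g (suc j) <? - head g) (ℤ.<-trans (neg (suc j)) 0<-g₀))

increasing-in-[1,n]⇒≡index : ∀ {n} (g : Fin (suc n) → ℤ) →
  (∀ k → g (inject₁ k) <ℤ g (suc k)) → + 1 ≤ℤ g zero → (∀ j → g j ≤ℤ + suc n) →
  ∀ j → g j ≡ + suc (toℕ j)
increasing-in-[1,n]⇒≡index {n} g step 1≤g₀ g≤n j = ℤ.≤-antisym (upper j) (lower j)
  where
  lower : ∀ j → + suc (toℕ j) ≤ℤ g j
  lower = <-weakInduction (λ j → + suc (toℕ j) ≤ℤ g j) 1≤g₀ λ k ih →
    ℤ.i<j⇒suc[i]≤j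
      (ℤ.≤-<-trans (subst (λ m → + suc m ≤ℤ g (inject₁ k)) (toℕ-inject₁ k) ih) (step k))
  upper : ∀ j → g j ≤ℤ + suc (toℕ j)
  upper = >-weakInduction (λ j → g j ≤ℤ + suc (toℕ j))
    (subst (λ m → g (fromℕ n) ≤ℤ + suc m) (sym (toℕ-fromℕ n)) (g≤n (fromℕ n))) λ k ih →
    subst (λ m → g (inject₁ k) ≤ℤ + suc m) (sym (toℕ-inject₁ k))
      (ℤ.i<j⇒i≤pred[j] (ℤ.<-≤-trans (step k) ih))

toℤ-neg : ∀ {n} (x : S n) → toℤ (neg x) ≡ - toℤ x
toℤ-neg (false , j) = refl
toℤ-neg (true  , j) = refl

toℤ-injective : ∀ {n} {x y : S n} → toℤ x ≡ toℤ y → x ≡ y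
toℤ-injective {x = false , i} {false , j} eq =
  cong (false ,_) (toℕ-injective (suc-injective (ℤ.+-injective eq)))
toℤ-injective {x = true  , i} {true  , j} eq =
  cong (true ,_) (toℕ-injective (ℤ.-[1+-injective eq))
toℤ-injective {x = false , i} {true  , j} ()
toℤ-injective {x = true  , i} {false , j} ()

toℤ≤n : ∀ {n} (x : S n) → toℤ x ≤ℤ + n
toℤ≤n (false , i) = +≤+ (toℕ<n i)
toℤ≤n (true  , i) = -≤+

toℤ≮0⇒1≤toℤ : ∀ {n} (x : S n) → ¬ toℤ x <ℤ 0ℤ → + 1 ≤ℤ toℤ x
toℤ≮0⇒1≤toℤ (false , i) _    = +≤+ (s≤s z≤n)
toℤ≮0⇒1≤toℤ (true  , i) ≮0 = contradiction -<+ ≮0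

neg-involutive : ∀ {n} (x : S n) → neg (neg x) ≡ x
neg-involutive (s , j) = cong (_, j) (not-involutive s)

fun-injective : ∀ {n} (γ : SignedPerm n) {x y} → fun γ x ≡ fun γ y → x ≡ y
fun-injective γ {x} {y} eq = begin
  x                ≡⟨ inv∘fun γ x ⟨
  inv γ (fun γ x)  ≡⟨ cong (inv γ) eq ⟩
  inv γ (fun γ y)  ≡⟨ inv∘fun γ y ⟩
  y                ∎
  where open ≡-Reasoning

identity : ∀ {n} → SignedPerm n
identity = record
  { fun = id ; inv = id ; inv∘fun = λ _ → refl ; fun∘inv = λ _ → refl ; odd = λ _ → refl }

w₀ : ∀ {n} → SignedPerm n
w₀ = record
  { fun = neg ; inv = neg ; inv∘fun = neg-involutive ; fun∘inv = neg-involutive ; odd = λ _ → refl }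

identity-increasing : ∀ {n} → Increasing (oneLine (identity {n}))
identity-increasing i<j = +<+ (s≤s i<j)

w₀-decreasing : ∀ {n} → Decreasing (oneLine (w₀ {n}))
w₀-decreasing = -<-

increasing⇒noPeaks : ∀ {n} (σ : SignedPerm n) → Increasing (oneLine σ) → NoPeaks σ
increasing⇒noPeaks σ inc _ (_ , b , c , _ , _ , c≡1+b , _ , σc<σb) =
  ℤ.<-asym σc<σb (inc (subst (toℕ b <_) (sym c≡1+b) (n<1+n (toℕ b))))

decreasing⇒noPeaks : ∀ {n} (σ : SignedPerm n) → Decreasing (oneLine σ) → NoPeaks σ
decreasing⇒noPeaks σ dec _ (a , _ , _ , _ , 1+a≡b , _ , σa<σb , _) =
  ℤ.<-asym σa<σb (dec (subst (toℕ a <_) 1+a≡b (n<1+n (toℕ a))))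

gen-involutive : ∀ {n} (k : Fin n) x → gen k (gen k x) ≡ x
gen-involutive zero    (s , zero)  = cong (_, zero) (not-involutive s)
gen-involutive zero    (s , suc j) = refl
gen-involutive (suc k) (s , j)     = cong (s ,_) (transpose-involutive (inject₁ k) (suc k) j)

gen-odd : ∀ {n} (k : Fin n) x → gen k (neg x) ≡ neg (gen k x)
gen-odd zero    (s , zero)  = refl
gen-odd zero    (s , suc j) = refl
gen-odd (suc k) (s , j)     = refl

generator : ∀ {n} → Fin n → SignedPerm n
generator k = record
  { fun = gen k ; inv = gen k
  ; inv∘fun = gen-involutive k ; fun∘inv = gen-involutive k ; odd = gen-odd k }

-- Right descents of type B, with the convention σ(0) = 0 for s₀.
Descent : ∀ {n} → SignedPerm n → Fin n → Set
Descent γ zero    = oneLine γ zero <ℤ 0ℤ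
Descent γ (suc k) = oneLine γ (suc k) <ℤ oneLine γ (inject₁ k)

descent? : ∀ {n} (γ : SignedPerm n) k → Dec (Descent γ k)
descent? γ zero    = oneLine γ zero <? 0ℤ
descent? γ (suc k) = oneLine γ (suc k) <? oneLine γ (inject₁ k)

inversionsB-·s₀ : ∀ {n} (γ : SignedPerm (suc n)) →
  inversionsB (oneLine γ) + 𝟙 (- oneLine γ zero <? 0ℤ) ≡
  inversionsB (oneLine (γ · generator zero)) + 𝟙 (oneLine γ zero <? 0ℤ)
inversionsB-·s₀ γ = trans (inversionsB-negateHead (oneLine γ zero) (tail (oneLine γ)))
                          (cong (_+ 𝟙 (oneLine γ zero <? 0ℤ)) (inversionsB-cong negated-head))
  where
  negated-head : (- oneLine γ zero) Vector.∷ tail (oneLine γ) ≗ oneLine (γ · generator zero)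
  negated-head zero    =
    sym (trans (cong toℤ (odd γ (false , zero))) (toℤ-neg (fun γ (false , zero))))
  negated-head (suc j) = refl

inversionsB-·generator-≤ : ∀ {n} (γ : SignedPerm n) k →
  inversionsB (oneLine (γ · generator k)) ≤ suc (inversionsB (oneLine γ))
inversionsB-·generator-≤ γ zero = exchange⇒≤suc _ _ (inversionsB-·s₀ γ)
inversionsB-·generator-≤ γ (suc k) = exchange⇒≤suc _ _ (inversionsB-transpose k (oneLine γ))

inversionsB-·generator-descent : ∀ {n} (γ : SignedPerm n) k → Descent γ k →
  inversionsB (oneLine γ) ≡ suc (inversionsB (oneLine (γ · generator k)))
inversionsB-·generator-descent γ zero d =
  exchange⇒≡suc _ _ (ℤ.<-asym (ℤ.neg-mono-< d)) d (inversionsB-·s₀ γ)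
inversionsB-·generator-descent γ (suc k) d =
  exchange⇒≡suc _ _ (ℤ.<-asym d) d (inversionsB-transpose k (oneLine γ))

noDescent⇒identity : ∀ {n} (γ : SignedPerm n) → (∀ k → ¬ Descent γ k) → ∀ x → fun γ x ≡ x
noDescent⇒identity {zero}  γ none (_ , ())
noDescent⇒identity {suc n} γ none = fixes
  where
  inject₁≢suc : ∀ k → inject₁ k ≢ suc k
  inject₁≢suc k eq = <-irrefl (trans (sym (toℕ-inject₁ k)) (cong toℕ eq)) (n<1+n (toℕ k))
  step : ∀ k → oneLine γ (inject₁ k) <ℤ oneLine γ (suc k)
  step k = ℤ.≤∧≢⇒< (ℤ.≮⇒≥ (none (suc k)))
    (inject₁≢suc k ∘ cong proj₂ ∘ fun-injective γ ∘ toℤ-injective)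
  fixes-positive : ∀ j → fun γ (false , j) ≡ (false , j)
  fixes-positive j = toℤ-injective (increasing-in-[1,n]⇒≡index (oneLine γ) step
    (toℤ≮0⇒1≤toℤ _ (none zero)) (toℤ≤n ∘ fun γ ∘ (false ,_)) j)
  fixes : ∀ x → fun γ x ≡ x
  fixes (false , j) = fixes-positive j
  fixes (true  , j) = trans (odd γ (false , j)) (cong neg (fixes-positive j))

inversionsB-identity : ∀ n → inversionsB (oneLine (identity {n})) ≡ 0
inversionsB-identity n =
  inversionsB-increasing-positive {n} (oneLine identity) (λ _ → +<+ (s≤s z≤n)) identity-increasing

inversionsB-w₀ : ∀ n → inversionsB (oneLine (w₀ {n})) ≡ n * n
inversionsB-w₀ n = inversionsB-decreasing-negative {n} (oneLine w₀) (λ _ → -<+) w₀-decreasing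

inversionsB-·word : ∀ {n} (w : List (Fin n)) (α γ : SignedPerm n) →
  (∀ x → fun γ x ≡ fun α (evalWord w x)) →
  inversionsB (oneLine γ) ≤ inversionsB (oneLine α) + length w
inversionsB-·word [] α γ γ≗α = ≤-reflexive (begin
  inversionsB (oneLine γ)      ≡⟨ inversionsB-cong (cong toℤ ∘ γ≗α ∘ (false ,_)) ⟩
  inversionsB (oneLine α)      ≡⟨ +-identityʳ _ ⟨
  inversionsB (oneLine α) + 0  ∎)
  where open ≡-Reasoning
inversionsB-·word (k ∷ w) α γ γ≗αkw = begin
  inversionsB (oneLine γ)
    ≤⟨ inversionsB-·word w (α · generator k) γ γ≗αkw ⟩
  inversionsB (oneLine (α · generator k)) + length w
    ≤⟨ +-monoˡ-≤ (length w) (inversionsB-·generator-≤ α k) ⟩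
  suc (inversionsB (oneLine α)) + length w
    ≡⟨ +-suc _ (length w) ⟨
  inversionsB (oneLine α) + suc (length w)
    ∎
  where open ≤-Reasoning

inversionsB≤length : ∀ {n} (γ : SignedPerm n) w → Expresses w γ → inversionsB (oneLine γ) ≤ length w
inversionsB≤length {n} γ w w↦γ =
  subst (λ m → inversionsB (oneLine γ) ≤ m + length w) (inversionsB-identity n)
        (inversionsB-·word w identity γ (sym ∘ w↦γ))

evalWord-∷ʳ : ∀ {n} (w : List (Fin n)) k x → evalWord (w ∷ʳ k) x ≡ evalWord w (gen k x)
evalWord-∷ʳ []      k x = refl
evalWord-∷ʳ (l ∷ w) k x = cong (gen l) (evalWord-∷ʳ w k x)

expresses-∷ʳ : ∀ {n} (w : List (Fin n)) γ k → Expresses w (γ · generator k) → Expresses (w ∷ʳ k) γ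
expresses-∷ʳ w γ k w↦γs x = begin
  evalWord (w ∷ʳ k) x      ≡⟨ evalWord-∷ʳ w k x ⟩
  evalWord w (gen k x)     ≡⟨ w↦γs (gen k x) ⟩
  fun γ (gen k (gen k x))  ≡⟨ cong (fun γ) (gen-involutive k x) ⟩
  fun γ x                  ∎
  where open ≡-Reasoning

reducedWord : ∀ {n} (γ : SignedPerm n) m → inversionsB (oneLine γ) ≡ m →
  Σ[ w ∈ List (Fin n) ] (Expresses w γ × length w ≡ m)
reducedWord γ zero ι≡0 = [] , sym ∘ noDescent⇒identity γ noDescent , refl
  where
  noDescent : ∀ k → ¬ Descent γ k
  noDescent k d = 0≢1+n (trans (sym ι≡0) (inversionsB-·generator-descent γ k d))
reducedWord {n} γ (suc m) ι≡1+m with any? (descent? γ)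
... | no none = contradiction (trans (sym ι≡1+m) ι≡0) 1+n≢0
  where
  ι≡0 : inversionsB (oneLine γ) ≡ 0
  ι≡0 = trans
    (inversionsB-cong (cong toℤ ∘ noDescent⇒identity γ (λ k d → none (k , d)) ∘ (false ,_)))
    (inversionsB-identity n)
... | yes (k , d) with reducedWord (γ · generator k) m
                        (suc-injective (trans (sym (inversionsB-·generator-descent γ k d)) ι≡1+m))
...   | w , w↦γs , len≡m =
  w ∷ʳ k , expresses-∷ʳ w γ k w↦γs ,
  trans (length-++ w) (trans (+-comm (length w) 1) (cong suc len≡m))

lengthB-inversionsB : ∀ {n} (γ : SignedPerm n) → LengthB γ (inversionsB (oneLine γ))
lengthB-inversionsB γ = reducedWord γ _ refl , inversionsB≤length γ

lengthB-unique : ∀ {n} (γ : SignedPerm n) {m m′} → LengthB γ m → LengthB γ m′ → m ≡ m′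
lengthB-unique γ ((w , w↦γ , len≡m) , m-min) ((w′ , w′↦γ , len≡m′) , m′-min) =
  ≤-antisym (subst (_ ≤_) len≡m′ (m-min w′ w′↦γ)) (subst (_ ≤_) len≡m (m′-min w w↦γ))

corollary4p2 : (n : ℕ) → .{{_ : NonZero n}} →
    (Σ[ σ ∈ SignedPerm n ] Σ[ ρ ∈ SignedPerm n ]
       (NoPeaks σ × NoPeaks ρ × WordDist σ ρ (n * n)))
    × (∀ (σ ρ : SignedPerm n) (m : ℕ) → NoPeaks σ → NoPeaks ρ →
         WordDist σ ρ m → m ≤ n * n)
corollary4p2 n =
  ( w₀ , identity
  , decreasing⇒noPeaks w₀ w₀-decreasing
  , increasing⇒noPeaks identity identity-increasing
  , subst (LengthB γ₀) (inversionsB-w₀ n) (lengthB-inversionsB γ₀) )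
  , diameter
  where
  γ₀ : SignedPerm n
  γ₀ = (identity ⁻¹) · w₀
  diameter : ∀ (σ ρ : SignedPerm n) m → NoPeaks σ → NoPeaks ρ → WordDist σ ρ m → m ≤ n * n
  diameter σ ρ m _ _ d = begin
    m                        ≡⟨ lengthB-unique γ d (lengthB-inversionsB γ) ⟩
    inversionsB (oneLine γ)  ≤⟨ inversionsB≤n² (oneLine γ) ⟩
    n * n                    ∎
    where
    open ≤-Reasoning
    γ : SignedPerm n
    γ = (ρ ⁻¹) · σ
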